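{- Let $\mathcal T$ be a typed combinatory algebra in which $|\bot|$ is inhabited, and let $(C,\gamma)$ be a predicate on an assembly $(X,A,\alpha)$. Define $\beta(x)=\alpha(x)$ if $\gamma(x)=\emptyset$ and $\beta(x)=\emptyset$ otherwise (i.e. $\beta(x)=\bigcup\{\alpha(x):\gamma(x)=\emptyset\}$). Then $(A,\beta)$ is a predicate on $(X,A,\alpha)$ and $(A,\beta)\le(C,\gamma)\Rightarrow(\bot,\emptyset)$ and $(C,\gamma)\Rightarrow(\bot,\emptyset)\le(A,\beta)$; that is, $(A,\beta)$ is a negation of $(C,\gamma)$ in the pre-Heyting algebra of predicates on $(X,A,\alpha)$.
   Context: A typed combinatory algebra (tca) $\mathcal{T}$ consists of a set of types containing $\bot,\top,N$ and closed under $\times,\to,+$; sets $|T|$; total application maps $|S\to T|\times|S|\to|T|$, $(a,b)\mapsto ab$; and elements $\mathsf{exf},\mathsf t,\mathsf k,\mathsf s,\mathsf{pair},\mathsf{fst},\mathsf{snd},\mathsf{inl},\mathsf{inr},\mathsf{case},\mathsf 0,\mathsf{succ},\mathsf R$ of the appropriate types satisfying the usual combinator, pairing, case and recursion equations ($\mathsf{k}ab=a$, $\mathsf{s}abc=ac(bc)$, $\mathsf{fst}(\mathsf{pair}ab)=a$, $\mathsf{snd}(\mathsf{pair}ab)=b$, etc.). An assembly is $(X,A,\alpha)$ with $X$ a set, $A$ a type, $\alpha(x)\subseteq|A|$ inhabited. A predicate on $(X,A,\alpha)$ is a pair $(B,\beta)$ of a type $B$ and a function assigning to each $x\in X$ a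 subset $\beta(x)\subseteq|B|$ (possibly empty), such that some $f\in|B\to A|$ satisfies $b\in\beta(x)\Rightarrow fb\in\alpha(x)$. Preorder: $(B,\beta)\le(C,\gamma)$ iff some $f\in|B\to C|$ satisfies $b\in\beta(x)\Rightarrow fb\in\gamma(x)$ for all $x$. The bottom predicate is $(\bot,\emptyset)$ (empty at every $x$). Implication: $(C,\gamma)\Rightarrow(D,\delta)$ is $(A\times(C\to D),\epsilon)$ where $p\in\epsilon(x)$ iff $\mathsf{fst}\,p\in\alpha(x)$ and $\mathsf{snd}\,p\in|C\to D|$ satisfies $(\mathsf{snd}\,p)n\in\delta(x)$ for all $n\in\gamma(x)$. -}

module Defs where

open import Data.Empty using (⊥)
open import Data.Product using (Σ; ∃; _×_; _,_)
open import Relation.Nullary using (¬_)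
open import Relation.Binary.PropositionalEquality using (_≡_)

-- Typed combinatory algebra.  The set of types is given by a carrier `Ty`
-- containing ⊥, ⊤, N and closed under ×, →, + (written _⊗_, _⇒_, _⊕_).
record TCA : Set₁ where
  infixl 40 _·_
  infixr 25 _⇒_
  infixr 30 _⊗_
  infixr 28 _⊕_
  field
    Ty   : Set
    𝟘    : Ty
    𝟙    : Ty
    N    : Ty
    _⊗_  : Ty → Ty → Ty
    _⇒_  : Ty → Ty → Ty
    _⊕_  : Ty → Ty → Ty
    ∣_∣  : Ty → Set
    _·_  : ∀ {S T} → ∣ S ⇒ T ∣ → ∣ S ∣ → ∣ T ∣
    exf  : ∀ {A} → ∣ 𝟘 ⇒ A ∣
    t    : ∣ 𝟙 ∣
    k    : ∀ {A B} → ∣ A ⇒ B ⇒ A ∣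
    s    : ∀ {A B C} → ∣ (A ⇒ B ⇒ C) ⇒ (A ⇒ B) ⇒ A ⇒ C ∣
    pair : ∀ {A B} → ∣ A ⇒ B ⇒ A ⊗ B ∣
    fst  : ∀ {A B} → ∣ A ⊗ B ⇒ A ∣
    snd  : ∀ {A B} → ∣ A ⊗ B ⇒ B ∣
    inl  : ∀ {A B} → ∣ A ⇒ A ⊕ B ∣
    inr  : ∀ {A B} → ∣ B ⇒ A ⊕ B ∣
    case : ∀ {A B C} → ∣ (A ⇒ C) ⇒ (B ⇒ C) ⇒ A ⊕ B ⇒ C ∣
    zero : ∣ N ∣
    succ : ∣ N ⇒ N ∣
    R    : ∀ {A} → ∣ A ⇒ (N ⇒ A ⇒ A) ⇒ N ⇒ A ∣
    k-eq    : ∀ {A B} (a : ∣ A ∣) (b : ∣ B ∣) → k · a · b ≡ a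
    s-eq    : ∀ {A B C} (a : ∣ A ⇒ B ⇒ C ∣) (b : ∣ A ⇒ B ∣) (c : ∣ A ∣) →
              s · a · b · c ≡ a · c · (b · c)
    fst-eq  : ∀ {A B} (a : ∣ A ∣) (b : ∣ B ∣) → fst · (pair · a · b) ≡ a
    snd-eq  : ∀ {A B} (a : ∣ A ∣) (b : ∣ B ∣) → snd · (pair · a · b) ≡ b
    case-inl : ∀ {A B C} (f : ∣ A ⇒ C ∣) (g : ∣ B ⇒ C ∣) (a : ∣ A ∣) →
               case · f · g · (inl · a) ≡ f · a
    case-inr : ∀ {A B C} (f : ∣ A ⇒ C ∣) (g : ∣ B ⇒ C ∣) (b : ∣ B ∣) →
               case · f · g · (inr · b) ≡ g · b
    R-zero  : ∀ {A} (a : ∣ A ∣) (f : ∣ N ⇒ A ⇒ A ∣) → R · a · f · zero ≡ a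
    R-succ  : ∀ {A} (a : ∣ A ∣) (f : ∣ N ⇒ A ⇒ A ∣) (n : ∣ N ∣) →
              R · a · f · (succ · n) ≡ f · n · (R · a · f · n)

module _ (𝒯 : TCA) where
  open TCA 𝒯

  record Assembly : Set₁ where
    field
      X   : Set
      A   : Ty
      α   : X → ∣ A ∣ → Set
      inh : ∀ x → ∃ λ a → α x a

  RawPred : Set → Set₁
  RawPred X = Σ Ty (λ B → X → ∣ B ∣ → Set)

  IsPredicate : (𝒳 : Assembly) → RawPred (Assembly.X 𝒳) → Set
  IsPredicate 𝒳 (B , β) =
    ∃ λ (f : ∣ B ⇒ Assembly.A 𝒳 ∣) → ∀ x b → β x b → Assembly.α 𝒳 x (f · b)

  _≤P_ : ∀ {X} → RawPred X → RawPred X → Set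
  (B , β) ≤P (C , γ) = ∃ λ (f : ∣ B ⇒ C ∣) → ∀ x b → β x b → γ x (f · b)

  ⊥P : ∀ {X} → RawPred X
  ⊥P = 𝟘 , λ _ _ → ⊥

  ImpP : (𝒳 : Assembly) → RawPred (Assembly.X 𝒳) → RawPred (Assembly.X 𝒳) →
         RawPred (Assembly.X 𝒳)
  ImpP 𝒳 (C , γ) (D , δ) =
    (Assembly.A 𝒳 ⊗ (C ⇒ D)) ,
    λ x p → Assembly.α 𝒳 x (fst · p) × (∀ n → γ x n → δ x (snd · p · n))

  negβ : (𝒳 : Assembly) → RawPred (Assembly.X 𝒳) →
         Assembly.X 𝒳 → ∣ Assembly.A 𝒳 ∣ → Set
  negβ 𝒳 (C , γ) x a = Assembly.α 𝒳 x a × (∀ c → ¬ γ x c)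

{-# OPTIONS --safe #-}
-- A realizer of β at x,
-- paired with any element of |C → ⊥| (the constant map k b for b ∈ |⊥|),
-- realizes (C,γ) ⇒ (⊥,∅), the implication part being vacuous; conversely
-- fst recovers the α-realizer, and γ(x) is empty since it maps into the
-- empty fibre of (⊥,∅).
module Submission where

open import Defs
open import Data.Empty using (⊥-elim)
open import Data.Product using (_×_; _,_; proj₁; proj₂)
open import Relation.Binary.PropositionalEquality using (_≡_; subst; sym; trans; cong)

module Combinators (𝒯 : TCA) where
  open TCA 𝒯

  id : ∀ {A} → ∣ A ⇒ A ∣
  id {A} = s · k · k {A} {A}

  id-eq : ∀ {A} (a : ∣ A ∣) → id · a ≡ a
  id-eq a = trans (s-eq k k a) (k-eq a (k · a))

  s-constʳ-eq : ∀ {A B C} (f : ∣ A ⇒ B ⇒ C ∣) (b : ∣ B ∣) (a : ∣ A ∣) →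
                s · f · (k · b) · a ≡ f · a · b
  s-constʳ-eq f b a = trans (s-eq f (k · b) a) (cong (f · a ·_) (k-eq b a))

module Negation (𝒯 : TCA) (𝒳 : Assembly 𝒯) where
  open TCA 𝒯
  open Assembly 𝒳
  open Combinators 𝒯

  ⊆α⇒isPredicate : (β : X → ∣ A ∣ → Set) → (∀ x a → β x a → α x a) →
                   IsPredicate 𝒯 𝒳 (A , β)
  ⊆α⇒isPredicate β β⊆α = id , λ x a βxa → subst (α x) (sym (id-eq a)) (β⊆α x a βxa)

  negβ-isPredicate : (P : RawPred 𝒯 X) → IsPredicate 𝒯 𝒳 (A , negβ 𝒯 𝒳 P)
  negβ-isPredicate P = ⊆α⇒isPredicate (negβ 𝒯 𝒳 P) (λ _ _ → proj₁)

  negβ≤⇒ : (P Q : RawPred 𝒯 X) → ∣ proj₁ P ⇒ proj₁ Q ∣ →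
           _≤P_ 𝒯 (A , negβ 𝒯 𝒳 P) (ImpP 𝒯 𝒳 P Q)
  negβ≤⇒ P Q e = s · pair · (k · e) , realizes
    where
    realizes : ∀ x a → negβ 𝒯 𝒳 P x a → proj₂ (ImpP 𝒯 𝒳 P Q) x (s · pair · (k · e) · a)
    realizes x a (αxa , Px-empty) rewrite s-constʳ-eq pair e a | fst-eq a e =
      αxa , λ c Pxc → ⊥-elim (Px-empty c Pxc)

  ⇒⊥≤negβ : (P : RawPred 𝒯 X) → _≤P_ 𝒯 (ImpP 𝒯 𝒳 P (⊥P 𝒯)) (A , negβ 𝒯 𝒳 P)
  ⇒⊥≤negβ P = fst , λ x p (αx-fst-p , refutes) → αx-fst-p , refutes

mainTheorem19 : (𝒯 : TCA) → TCA.∣_∣ 𝒯 (TCA.𝟘 𝒯) →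
    (𝒳 : Assembly 𝒯) → (P : RawPred 𝒯 (Assembly.X 𝒳)) → IsPredicate 𝒯 𝒳 P →
    IsPredicate 𝒯 𝒳 (Assembly.A 𝒳 , negβ 𝒯 𝒳 P)
    × _≤P_ 𝒯 (Assembly.A 𝒳 , negβ 𝒯 𝒳 P) (ImpP 𝒯 𝒳 P (⊥P 𝒯))
    × _≤P_ 𝒯 (ImpP 𝒯 𝒳 P (⊥P 𝒯)) (Assembly.A 𝒳 , negβ 𝒯 𝒳 P)
mainTheorem19 𝒯 b 𝒳 P _ =
  negβ-isPredicate P , negβ≤⇒ P (⊥P 𝒯) (k · b) , ⇒⊥≤negβ P
  where
  open TCA 𝒯 using (_·_; k)
  open Negation 𝒯 𝒳
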